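{- Let $Q$ be an odd prime power and $F_5(X):=X-\mathrm{Tr}_{Q^4/Q^2}(X^{Q^3-Q+1})$. Let $S$ be the set of $x\in\mathbb{F}_{Q^4}^*$ with $x^{2Q^2}-x^{Q^2+1}+x^2=0$. Then $S$ is nonempty only when $3\mid Q$, in which case $S$ consists of the elements $x\in\mathbb{F}_{Q^4}$ with $x^{Q^2-1}=-1$, and $F_5$ fixes each element of $S$.
   Context: $\mathrm{Tr}_{Q^4/Q^2}(X)$ denotes the polynomial $X^{Q^2}+X$. -}

module Defs where

open import Level using (Level; _⊔_)
open import Data.Nat using (ℕ; _≤_; _^_; _∸_)
import Data.Nat as ℕ
open import Data.Nat.Primality using (Prime)
open import Data.Nat.Divisibility using (_∣_)
open import Data.Fin using (Fin)
open import Data.Product using (Σ; ∃; _×_)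
open import Relation.Binary.PropositionalEquality using (_≡_)
open import Relation.Nullary using (¬_)
open import Algebra.Bundles using (CommutativeRing; Semiring)
import Algebra.Definitions.RawSemiring as RS

IsPrimePower : ℕ → Set
IsPrimePower Q = Σ ℕ λ p → Σ ℕ λ k → Prime p × 1 ≤ k × Q ≡ p ^ k

Odd : ℕ → Set
Odd Q = ¬ (2 ∣ Q)

module FieldNotions {c ℓ : Level} (K : CommutativeRing c ℓ) where
  open CommutativeRing K
  open RS (Semiring.rawSemiring semiring) public using () renaming (_^_ to _^ᴷ_)

  IsField : Set (c ⊔ ℓ)
  IsField = ¬ (1# ≈ 0#) × (∀ x → ¬ (x ≈ 0#) → ∃ λ y → x * y ≈ 1#)

  HasCard : ℕ → Set (c ⊔ ℓ)
  HasCard n = Σ (Fin n → Carrier) λ f →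
                (∀ i j → f i ≈ f j → i ≡ j) × (∀ x → ∃ λ i → f i ≈ x)

  -- Tr_{Q^4/Q^2}(X) = X^{Q^2} + X
  Tr : ℕ → Carrier → Carrier
  Tr Q y = y ^ᴷ (Q ^ 2) + y

  F5 : ℕ → Carrier → Carrier
  F5 Q x = x - Tr Q (x ^ᴷ (Q ^ 3 ∸ Q ℕ.+ 1))

  InS : ℕ → Carrier → Set ℓ
  InS Q x = ¬ (x ≈ 0#) × (x ^ᴷ (2 ℕ.* Q ^ 2) - x ^ᴷ (Q ^ 2 ℕ.+ 1) + x ^ᴷ 2 ≈ 0#)

{-# OPTIONS --safe #-}
-- With N = Q², every x ≠ 0 in the field K of order N² satisfies x^(N²) = x, so
-- t = x^(N−1) is an (N+1)-th root of unity, and the defining equation of S reads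
-- x² Φ₆(t) = 0 with Φ₆(t) = t² − t + 1. A root of Φ₆ satisfies t⁶ = 1. If 3 ∤ Q then
-- N + 1 ≡ 2 (mod 6), so t² = 1, which together with Φ₆(t) = 0 gives 3 = 0 in K;
-- impossible, as Q⁴ · 1 = 0 and Q⁴ ≡ 1 (mod 3). In characteristic 3, Φ₆(t) = (t + 1)²,
-- so S = {x : x^(N−1) = −1}. For such x, x^N = −x, hence x^(Q³) = −x^Q (Q is odd),
-- x^(Q³−Q+1) = −x, and Tr(−x) = (−x)^N − x = 0.
module Submission where

open import Defs
open import Level using (Level)
open import Data.Nat as ℕ using (ℕ; zero; suc; _^_; _∸_)
import Data.Nat.Properties as ℕP
open import Data.Nat.Divisibility using (_∣_)
open import Data.Product using (∃; _×_; _,_; proj₁; proj₂)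
open import Data.Fin as Fin using (Fin)
open import Algebra.Bundles using (CommutativeRing; CommutativeMonoid)
open import Function using (_∘_)
open import Relation.Binary.PropositionalEquality as ≡ using (_≡_; _≢_)
open import Relation.Nullary using (¬_; Dec; yes; no)

module _ where
  open import Data.Nat
  open import Data.Nat.Properties
  open import Data.Nat.Divisibility
  open import Data.Nat.Primality
  open import Data.Nat.Tactic.RingSolver using (solve)
  open import Data.List using (_∷_; [])
  open import Data.Sum using (inj₁; inj₂)
  open import Relation.Nullary using (contradiction)
  open ≡ using (refl; cong)

  ∣^⇒∣ : ∀ {p} m k → Prime p → p ∣ m ^ k → p ∣ m
  ∣^⇒∣ m zero    p-prime p∣1 with refl ← ∣1⇒≡1 p∣1 = contradiction p-prime ¬prime[1]
  ∣^⇒∣ m (suc k) p-prime p∣m^[1+k] with euclidsLemma m (m ^ k) p-prime p∣m^[1+k]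
  ... | inj₁ p∣m   = p∣m
  ... | inj₂ p∣m^k = ∣^⇒∣ m k p-prime p∣m^k

  prime∣prime^⇒≡ : ∀ {p q} k → Prime p → Prime q → p ∣ q ^ k → p ≡ q
  prime∣prime^⇒≡ {q = q} k p-prime q-prime p∣q^k
    with prime⇒irreducible q-prime (∣^⇒∣ q k p-prime p∣q^k)
  ... | inj₁ refl = contradiction p-prime ¬prime[1]
  ... | inj₂ p≡q  = p≡q

  ¬2∣⇒¬2∣^ : ∀ {m} k → ¬ 2 ∣ m → ¬ 2 ∣ m ^ k
  ¬2∣⇒¬2∣^ k ¬2∣m 2∣m^k = ¬2∣m (∣^⇒∣ _ k prime[2] 2∣m^k)

  ¬2∣⇒nonZero : ∀ {m} → ¬ 2 ∣ m → NonZero m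
  ¬2∣⇒nonZero {zero}  ¬2∣0 = contradiction (divides 0 refl) ¬2∣0
  ¬2∣⇒nonZero {suc m} _    = _

  m≡suc[m∸1] : ∀ m .{{_ : NonZero m}} → m ≡ suc (m ∸ 1)
  m≡suc[m∸1] (suc m) = refl

  n*n≡1+6*k : ∀ n → ¬ 2 ∣ n → ¬ 3 ∣ n → ∃ λ k → n * n ≡ 1 + 6 * k
  n*n≡1+6*k 0 ¬2∣n ¬3∣n = contradiction (divides 0 refl) ¬2∣n
  n*n≡1+6*k 1 ¬2∣n ¬3∣n = 0 , refl
  n*n≡1+6*k 2 ¬2∣n ¬3∣n = contradiction (divides 1 refl) ¬2∣n
  n*n≡1+6*k 3 ¬2∣n ¬3∣n = contradiction (divides 1 refl) ¬3∣n
  n*n≡1+6*k 4 ¬2∣n ¬3∣n = contradiction (divides 2 refl) ¬2∣n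
  n*n≡1+6*k 5 ¬2∣n ¬3∣n = 4 , refl
  n*n≡1+6*k (suc (suc (suc (suc (suc (suc n)))))) ¬2∣6+n ¬3∣6+n
    with k , n*n≡1+6k ← n*n≡1+6*k n (¬2∣6+n ∘ ∣m∣n⇒∣m+n (divides 3 refl))
                                    (¬3∣6+n ∘ ∣m∣n⇒∣m+n (divides 2 refl))
    = k + 6 + 2 * n , (begin
      (6 + n) * (6 + n)            ≡⟨ solve (n ∷ []) ⟩
      n * n + (36 + 12 * n)        ≡⟨ cong (_+ (36 + 12 * n)) n*n≡1+6k ⟩
      1 + 6 * k + (36 + 12 * n)    ≡⟨ solve (k ∷ n ∷ []) ⟩
      1 + 6 * (k + 6 + 2 * n)      ∎)
    where open ≡.≡-Reasoning

  suc[[m∸1]*[m+1]]≡m*m : ∀ m .{{_ : NonZero m}} → suc ((m ∸ 1) * (m + 1)) ≡ m * m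
  suc[[m∸1]*[m+1]]≡m*m (suc m) = identity m
    where
    identity : ∀ m → suc (m * (suc m + 1)) ≡ suc m * suc m
    identity m = solve (m ∷ [])

  [1+6k]*[1+6k]≡1+3*[4k+12k*k] : ∀ k → (1 + 6 * k) * (1 + 6 * k) ≡ 1 + 3 * (4 * k + 12 * k * k)
  [1+6k]*[1+6k]≡1+3*[4k+12k*k] k = solve (k ∷ [])

  m+[n∸m+1]≡n+1 : ∀ {m n} → m ≤ n → m + (n ∸ m + 1) ≡ n + 1
  m+[n∸m+1]≡n+1 {m} {n} m≤n = ≡.trans (≡.sym (+-assoc m (n ∸ m) 1)) (cong (_+ 1) (m+[n∸m]≡n m≤n))

-- The solver decides equalities by normalising both sides, so its coefficients must
-- compute: they are taken from ℤ and interpreted through the canonical map ℤ → K.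
module IntegerCoefficientSolver {c ℓ : Level} (K : CommutativeRing c ℓ) where
  open CommutativeRing K
  open import Algebra.Properties.Ring ring
    using (-‿involutive; -0#≈0#; -‿+-comm; -‿distribˡ-*; -‿distribʳ-*)
  open import Algebra.Properties.Semiring.Mult.TCOptimised semiring
    using (1+×; ×-homo-+; ×1-homo-*) renaming (_×_ to _×′_)
  open import Algebra.Solver.Ring.AlmostCommutativeRing
    using (fromCommutativeRing; _-Raw-AlmostCommutative⟶_)
  open import Data.Integer as ℤ using (ℤ; +_; -[1+_]; _⊖_)
  import Data.Integer.Properties as ℤ
  open import Data.Sign as Sign using (Sign)
  open import Data.Maybe using (Maybe; map)
  open import Relation.Nullary.Decidable using (dec⇒maybe)
  open import Relation.Binary.Reasoning.Setoid setoid

  private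
    signed : Sign → Carrier → Carrier
    signed Sign.+ x = x
    signed Sign.- x = - x

    ⟦_⟧ℤ : ℤ → Carrier
    ⟦ i ⟧ℤ = signed (ℤ.sign i) (ℤ.∣ i ∣ ×′ 1#)

    signed-cong : ∀ s {x y} → x ≈ y → signed s x ≈ signed s y
    signed-cong Sign.+ x≈y = x≈y
    signed-cong Sign.- x≈y = -‿cong x≈y

    signed-* : ∀ s t x y → signed (s Sign.* t) (x * y) ≈ signed s x * signed t y
    signed-* Sign.+ Sign.+ x y = refl
    signed-* Sign.+ Sign.- x y = -‿distribʳ-* x y
    signed-* Sign.- Sign.+ x y = -‿distribˡ-* x y
    signed-* Sign.- Sign.- x y = begin
      x * y           ≈⟨ -‿involutive (x * y) ⟨
      - - (x * y)     ≈⟨ -‿cong (-‿distribʳ-* x y) ⟩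
      - (x * - y)     ≈⟨ -‿distribˡ-* x (- y) ⟩
      - x * - y       ∎

    ◃-homo : ∀ s n → ⟦ s ℤ.◃ n ⟧ℤ ≈ signed s (n ×′ 1#)
    ◃-homo Sign.+ zero    = refl
    ◃-homo Sign.- zero    = sym -0#≈0#
    ◃-homo Sign.+ (suc n) = refl
    ◃-homo Sign.- (suc n) = refl

    ⊖-homo : ∀ m n → ⟦ m ⊖ n ⟧ℤ ≈ m ×′ 1# - n ×′ 1#
    ⊖-homo m       zero    = sym (trans (+-congˡ -0#≈0#) (+-identityʳ _))
    ⊖-homo zero    (suc n) = sym (+-identityˡ _)
    ⊖-homo (suc m) (suc n) = begin
      ⟦ suc m ⊖ suc n ⟧ℤ                   ≡⟨ ≡.cong ⟦_⟧ℤ (ℤ.[1+m]⊖[1+n]≡m⊖n m n) ⟩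
      ⟦ m ⊖ n ⟧ℤ                           ≈⟨ ⊖-homo m n ⟩
      m ×′ 1# - n ×′ 1#                    ≈⟨ shift _ _ ⟩
      (1# + m ×′ 1#) - (1# + n ×′ 1#)      ≈⟨ +-cong (1+× m 1#) (-‿cong (1+× n 1#)) ⟨
      suc m ×′ 1# - suc n ×′ 1#            ∎
      where
      shift : ∀ a b → a - b ≈ (1# + a) - (1# + b)
      shift a b = begin
        a - b                      ≈⟨ +-identityˡ _ ⟨
        0# + (a - b)               ≈⟨ +-congʳ (-‿inverseʳ 1#) ⟨
        (1# - 1#) + (a - b)        ≈⟨ +-assoc 1# (- 1#) _ ⟩
        1# + (- 1# + (a - b))      ≈⟨ +-congˡ (+-assoc (- 1#) a (- b)) ⟨
        1# + ((- 1# + a) - b)      ≈⟨ +-congˡ (+-congʳ (+-comm (- 1#) a)) ⟩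
        1# + ((a - 1#) - b)        ≈⟨ +-congˡ (+-assoc a (- 1#) (- b)) ⟩
        1# + (a + (- 1# - b))      ≈⟨ +-assoc 1# a _ ⟨
        (1# + a) + (- 1# - b)      ≈⟨ +-congˡ (-‿+-comm 1# b) ⟩
        (1# + a) - (1# + b)        ∎

    +-homo : ∀ i j → ⟦ i ℤ.+ j ⟧ℤ ≈ ⟦ i ⟧ℤ + ⟦ j ⟧ℤ
    +-homo -[1+ m ] -[1+ n ] = begin
      - (suc (suc (m ℕ.+ n)) ×′ 1#)        ≡⟨ ≡.cong (λ k → - (suc k ×′ 1#)) (ℕP.+-suc m n) ⟨
      - ((suc m ℕ.+ suc n) ×′ 1#)          ≈⟨ -‿cong (×-homo-+ 1# (suc m) (suc n)) ⟩
      - (suc m ×′ 1# + suc n ×′ 1#)         ≈⟨ -‿+-comm _ _ ⟨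
      - (suc m ×′ 1#) - suc n ×′ 1#         ∎
    +-homo -[1+ m ] (+ n)    = trans (⊖-homo n (suc m)) (+-comm _ _)
    +-homo (+ m)    -[1+ n ] = ⊖-homo m (suc n)
    +-homo (+ m)    (+ n)    = ×-homo-+ 1# m n

    *-homo : ∀ i j → ⟦ i ℤ.* j ⟧ℤ ≈ ⟦ i ⟧ℤ * ⟦ j ⟧ℤ
    *-homo i j = begin
      ⟦ s ℤ.◃ (ℤ.∣ i ∣ ℕ.* ℤ.∣ j ∣) ⟧ℤ                   ≈⟨ ◃-homo s (ℤ.∣ i ∣ ℕ.* ℤ.∣ j ∣) ⟩
      signed s ((ℤ.∣ i ∣ ℕ.* ℤ.∣ j ∣) ×′ 1#)             ≈⟨ signed-cong s (×1-homo-* ℤ.∣ i ∣ ℤ.∣ j ∣) ⟩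
      signed s (ℤ.∣ i ∣ ×′ 1# * ℤ.∣ j ∣ ×′ 1#)             ≈⟨ signed-* (ℤ.sign i) (ℤ.sign j) _ _ ⟩
      ⟦ i ⟧ℤ * ⟦ j ⟧ℤ                                  ∎
      where s = ℤ.sign i Sign.* ℤ.sign j

    -‿homo : ∀ i → ⟦ ℤ.- i ⟧ℤ ≈ - ⟦ i ⟧ℤ
    -‿homo -[1+ n ]      = sym (-‿involutive _)
    -‿homo (+ zero)      = sym -0#≈0#
    -‿homo (+ suc n)     = refl

    ℤ⟶K : ℤ.+-*-rawRing -Raw-AlmostCommutative⟶ fromCommutativeRing K
    ℤ⟶K = record
      { ⟦_⟧    = ⟦_⟧ℤ
      ; +-homo = +-homo
      ; *-homo = *-homo
      ; -‿homo = -‿homo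
      ; 0-homo = refl
      ; 1-homo = refl
      }

    ⟦⟧ℤ-≟ : ∀ i j → Maybe (⟦ i ⟧ℤ ≈ ⟦ j ⟧ℤ)
    ⟦⟧ℤ-≟ i j = map (reflexive ∘ ≡.cong ⟦_⟧ℤ) (dec⇒maybe (i ℤ.≟ j))

  open import Algebra.Solver.Ring ℤ.+-*-rawRing (fromCommutativeRing K) ℤ⟶K ⟦⟧ℤ-≟ public

module CommutativeRingProperties {c ℓ : Level} (K : CommutativeRing c ℓ) where
  open CommutativeRing K
  open FieldNotions K using (_^ᴷ_)
  open import Algebra.Properties.Ring ring using (-‿distribˡ-*; -‿involutive; -0#≈0#; x∙y⁻¹≈ε⇒x≈y; x≈y⇒x∙y⁻¹≈ε)
  open import Algebra.Properties.Semiring.Mult semiring using (×1-homo-*) renaming (_×_ to _×ᴷ_)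
  open import Algebra.Properties.Semiring.Mult.TCOptimised semiring using (×ᵤ≈×) renaming (_×_ to _×′_)
  open import Algebra.Properties.Semiring.Exp semiring using (^-homo-*; ^-assocʳ; ^-congˡ)
  open import Data.Nat.Divisibility using (divides; ∣m∣n⇒∣m+n; ∣-refl)
  open import Data.Integer using (+_)
  open import Relation.Binary.Reasoning.Setoid setoid
  open import Relation.Nullary using (contradiction)
  open IntegerCoefficientSolver K using (solve; _:=_; _:+_; _:*_; _:-_; :-_; _:^_; con)

  Φ₆ : Carrier → Carrier
  Φ₆ t = t * t - t + 1#

  -‿^-odd : ∀ k → ¬ 2 ∣ k → ∀ x → (- x) ^ᴷ k ≈ - (x ^ᴷ k)
  -‿^-odd zero                ¬2∣0   x = contradiction (divides 0 ≡.refl) ¬2∣0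
  -‿^-odd (suc zero)          _      x = sym (-‿distribˡ-* x 1#)
  -‿^-odd (suc (suc k))       ¬2∣2+k x = begin
    - x * (- x * (- x) ^ᴷ k)  ≈⟨ *-congˡ (*-congˡ (-‿^-odd k (¬2∣2+k ∘ ∣m∣n⇒∣m+n ∣-refl) x)) ⟩
    - x * (- x * - (x ^ᴷ k))  ≈⟨ solve 2 (λ x y → :- x :* (:- x :* :- y) := :- (x :* (x :* y))) refl x (x ^ᴷ k) ⟩
    - (x * (x * x ^ᴷ k))      ∎

  ^-periodic : ∀ {x p} → x ^ᴷ p ≈ 1# → ∀ r k → x ^ᴷ (r ℕ.+ p ℕ.* k) ≈ x ^ᴷ r
  ^-periodic {x} {p} x^p≈1 r k = begin
    x ^ᴷ (r ℕ.+ p ℕ.* k)        ≈⟨ ^-homo-* x r (p ℕ.* k) ⟩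
    x ^ᴷ r * x ^ᴷ (p ℕ.* k)      ≈⟨ *-congˡ (^-assocʳ x p k) ⟨
    x ^ᴷ r * (x ^ᴷ p) ^ᴷ k       ≈⟨ *-congˡ (^-congˡ k x^p≈1) ⟩
    x ^ᴷ r * 1# ^ᴷ k             ≈⟨ *-congˡ (1^≈1 k) ⟩
    x ^ᴷ r * 1#                  ≈⟨ *-identityʳ _ ⟩
    x ^ᴷ r                       ∎
    where
    1^≈1 : ∀ k → 1# ^ᴷ k ≈ 1#
    1^≈1 zero    = refl
    1^≈1 (suc k) = trans (*-identityˡ _) (1^≈1 k)

  [1+m*k]×1≈1 : ∀ m k → m ×ᴷ 1# ≈ 0# → suc (m ℕ.* k) ×ᴷ 1# ≈ 1#
  [1+m*k]×1≈1 m k m≈0 = begin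
    1# + (m ℕ.* k) ×ᴷ 1#          ≈⟨ +-congˡ (×1-homo-* m k) ⟩
    1# + m ×ᴷ 1# * k ×ᴷ 1#        ≈⟨ +-congˡ (*-congʳ m≈0) ⟩
    1# + 0# * k ×ᴷ 1#             ≈⟨ +-congˡ (zeroˡ _) ⟩
    1# + 0#                       ≈⟨ +-identityʳ 1# ⟩
    1#                            ∎

  ×1-homo-^ : ∀ m k → (m ℕ.^ k) ×ᴷ 1# ≈ (m ×ᴷ 1#) ^ᴷ k
  ×1-homo-^ m zero    = +-identityʳ 1#
  ×1-homo-^ m (suc k) = trans (×1-homo-* m (m ℕ.^ k)) (*-congˡ (×1-homo-^ m k))

  Φ₆≈0⇒^6≈1 : ∀ {t} → Φ₆ t ≈ 0# → t ^ᴷ 6 ≈ 1#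
  Φ₆≈0⇒^6≈1 {t} Φ₆[t]≈0 = x∙y⁻¹≈ε⇒x≈y _ _ (begin
    t ^ᴷ 6 - 1#                          ≈⟨ solve 1 (λ t → t :^ 6 :- con (+ 1) :=
                                               (t :* t :- t :+ con (+ 1)) :* ((t :+ con (+ 1)) :* (t :^ 3 :- con (+ 1)))) refl t ⟩
    Φ₆ t * ((t + 1#) * (t ^ᴷ 3 - 1#))   ≈⟨ *-congʳ Φ₆[t]≈0 ⟩
    0# * ((t + 1#) * (t ^ᴷ 3 - 1#))     ≈⟨ zeroˡ _ ⟩
    0#                                   ∎)

  Φ₆≈0⇒^2≈1⇒3×1≈0 : ∀ {t} → Φ₆ t ≈ 0# → t ^ᴷ 2 ≈ 1# → 3 ×ᴷ 1# ≈ 0#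
  Φ₆≈0⇒^2≈1⇒3×1≈0 {t} Φ₆[t]≈0 t²≈1 = begin
    3 ×ᴷ 1#                                    ≈⟨ ×ᵤ≈× 3 1# ⟩
    3 ×′ 1#                                    ≈⟨ solve 1 (λ t → con (+ 3) :=
                                                    (t :^ 2 :- con (+ 1))
                                                    :- ((t :^ 2 :- con (+ 1)) :- (t :* t :- t :+ con (+ 1)))
                                                       :* (t :+ con (+ 1) :+ con (+ 1))) refl t ⟩
    (t ^ᴷ 2 - 1#) - ((t ^ᴷ 2 - 1#) - Φ₆ t) * (t + 1# + 1#)
                                               ≈⟨ +-cong t²-1≈0 (-‿cong (*-congʳ (+-cong t²-1≈0 (-‿cong Φ₆[t]≈0)))) ⟩
    0# - (0# - 0#) * (t + 1# + 1#)             ≈⟨ +-congˡ (-‿cong (trans (*-congʳ (-‿inverseʳ 0#)) (zeroˡ _))) ⟩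
    0# - 0#                                    ≈⟨ -‿inverseʳ 0# ⟩
    0#                                         ∎
    where t²-1≈0 = x≈y⇒x∙y⁻¹≈ε t²≈1

  3×1≈0⇒[t+1]^2≈Φ₆ : 3 ×ᴷ 1# ≈ 0# → ∀ t → (t + 1#) ^ᴷ 2 ≈ Φ₆ t
  3×1≈0⇒[t+1]^2≈Φ₆ 3×1≈0 t = begin
    (t + 1#) ^ᴷ 2          ≈⟨ solve 1 (λ t → (t :+ con (+ 1)) :^ 2 := (t :* t :- t :+ con (+ 1)) :+ con (+ 3) :* t) refl t ⟩
    Φ₆ t + 3 ×′ 1# * t     ≈⟨ +-congˡ (*-congʳ (trans (sym (×ᵤ≈× 3 1#)) 3×1≈0)) ⟩
    Φ₆ t + 0# * t          ≈⟨ +-congˡ (zeroˡ t) ⟩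
    Φ₆ t + 0#              ≈⟨ +-identityʳ _ ⟩
    Φ₆ t                   ∎

  3×1≈0⇒0^k≈-1⇒1≈0 : 3 ×ᴷ 1# ≈ 0# → ∀ k → 0# ^ᴷ k ≈ - 1# → 1# ≈ 0#
  3×1≈0⇒0^k≈-1⇒1≈0 3×1≈0 zero    1≈-1   = begin
    1#                     ≈⟨ solve 0 (con (+ 1) := con (+ 3) :- (con (+ 1) :- :- con (+ 1))) refl ⟩
    3 ×′ 1# - (1# - - 1#)  ≈⟨ +-cong (trans (sym (×ᵤ≈× 3 1#)) 3×1≈0) (-‿cong (+-congˡ (-‿cong (sym 1≈-1)))) ⟩
    0# - (1# - 1#)         ≈⟨ solve 0 (con (+ 0) :- (con (+ 1) :- con (+ 1)) := con (+ 0)) refl ⟩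
    0#                     ∎
  3×1≈0⇒0^k≈-1⇒1≈0 3×1≈0 (suc k) 0≈-1 = begin
    1#                     ≈⟨ -‿involutive 1# ⟨
    - - 1#                 ≈⟨ -‿cong 0≈-1 ⟨
    - (0# * 0# ^ᴷ k)       ≈⟨ -‿cong (zeroˡ _) ⟩
    - 0#                   ≈⟨ -0#≈0# ⟩
    0#                     ∎

module SumProperties {a ℓ} (M : CommutativeMonoid a ℓ) where
  open CommutativeMonoid M
  open import Algebra.Properties.CommutativeMonoid.Sum M
    using (sum; sum-permute; sum-remove; sum-cong-≋; sum-replicate-zero)
  open import Data.Fin.Permutation using (permutation)
  open import Data.Fin.Properties using (punchInᵢ≢i; _≟_)
  open import Relation.Binary.Reasoning.Setoid setoid

  sum-≈-at : ∀ {m} (u : Fin m → Carrier) i₀ → (∀ i → i ≢ i₀ → u i ≈ ε) → sum u ≈ u i₀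
  sum-≈-at {suc m} u i₀ u≈ε = begin
    sum u                                    ≈⟨ sum-remove {i = i₀} u ⟩
    u i₀ ∙ sum (λ j → u (Fin.punchIn i₀ j))  ≈⟨ ∙-congˡ (sum-cong-≋ (λ j → u≈ε _ (punchInᵢ≢i i₀ j))) ⟩
    u i₀ ∙ sum {m} (λ _ → ε)                 ≈⟨ ∙-congˡ (sum-replicate-zero m) ⟩
    u i₀ ∙ ε                                 ≈⟨ identityʳ (u i₀) ⟩
    u i₀                                     ∎

  module Enumeration {n : ℕ} (enum : Fin n → Carrier)
    (enum-injective : ∀ i j → enum i ≈ enum j → i ≡ j)
    (enum-surjective : ∀ x → ∃ λ i → enum i ≈ x) where

    ≈-dec : ∀ x y → Dec (x ≈ y)
    ≈-dec x y with i , eᵢ≈x ← enum-surjective x | j , eⱼ≈y ← enum-surjective y | i ≟ j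
    ... | yes ≡.refl = yes (trans (sym eᵢ≈x) eⱼ≈y)
    ... | no i≢j     = no (λ x≈y → i≢j (enum-injective i j (trans eᵢ≈x (trans x≈y (sym eⱼ≈y)))))

    sum-translate : ∀ {u v} → u ∙ v ≈ ε → (g : Carrier → Carrier) → (∀ {x y} → x ≈ y → g x ≈ g y) →
                    sum (g ∘ enum) ≈ sum (λ i → g (u ∙ enum i))
    sum-translate {u} {v} u∙v≈ε g g-cong = begin
      sum (g ∘ enum)               ≈⟨ sum-permute (g ∘ enum) π ⟩
      sum (g ∘ enum ∘ index u)     ≈⟨ sum-cong-≋ (λ i → g-cong (proj₂ (enum-surjective (u ∙ enum i)))) ⟩
      sum (λ i → g (u ∙ enum i))   ∎
      where
      v∙u≈ε : v ∙ u ≈ ε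
      v∙u≈ε = trans (comm v u) u∙v≈ε

      index : Carrier → Fin n → Fin n
      index w i = proj₁ (enum-surjective (w ∙ enum i))

      index-inverse : ∀ {w w′} → w ∙ w′ ≈ ε → ∀ i → index w (index w′ i) ≡ i
      index-inverse {w} {w′} w∙w′≈ε i = enum-injective _ _ (begin
        enum (index w (index w′ i))  ≈⟨ proj₂ (enum-surjective _) ⟩
        w ∙ enum (index w′ i)        ≈⟨ ∙-congˡ (proj₂ (enum-surjective _)) ⟩
        w ∙ (w′ ∙ enum i)            ≈⟨ assoc w w′ (enum i) ⟨
        (w ∙ w′) ∙ enum i            ≈⟨ ∙-congʳ w∙w′≈ε ⟩
        ε ∙ enum i                   ≈⟨ identityˡ (enum i) ⟩
        enum i                       ∎)

      π = permutation (index u) (index v) (index-inverse u∙v≈ε) (index-inverse v∙u≈ε)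

module Field {c ℓ : Level} (K : CommutativeRing c ℓ) (isField : FieldNotions.IsField K) where
  open CommutativeRing K
  open FieldNotions K using (_^ᴷ_)
  open import Relation.Binary.Reasoning.Setoid setoid
  open import Algebra.Properties.Ring ring using (x[y-z]≈xy-xz; x∙y⁻¹≈ε⇒x≈y; x≈y⇒x∙y⁻¹≈ε)
  open import Algebra.Properties.CommutativeMonoid.Sum *-commutativeMonoid using () renaming (sum to product)

  1≉0 : 1# ≉ 0#
  1≉0 = proj₁ isField

  x≉0∧x*y≈0⇒y≈0 : ∀ {x y} → x ≉ 0# → x * y ≈ 0# → y ≈ 0#
  x≉0∧x*y≈0⇒y≈0 {x} {y} x≉0 x*y≈0 with x⁻¹ , x*x⁻¹≈1 ← proj₂ isField x x≉0 = begin
    y                 ≈⟨ *-identityˡ y ⟨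
    1# * y            ≈⟨ *-congʳ x*x⁻¹≈1 ⟨
    (x * x⁻¹) * y     ≈⟨ *-congʳ (*-comm x x⁻¹) ⟩
    (x⁻¹ * x) * y     ≈⟨ *-assoc x⁻¹ x y ⟩
    x⁻¹ * (x * y)     ≈⟨ *-congˡ x*y≈0 ⟩
    x⁻¹ * 0#          ≈⟨ zeroʳ x⁻¹ ⟩
    0#                ∎

  *-≉0 : ∀ {x y} → x ≉ 0# → y ≉ 0# → x * y ≉ 0#
  *-≉0 x≉0 y≉0 = y≉0 ∘ x≉0∧x*y≈0⇒y≈0 x≉0

  ^-≉0 : ∀ {x} → x ≉ 0# → ∀ k → x ^ᴷ k ≉ 0#
  ^-≉0 x≉0 zero    = 1≉0
  ^-≉0 x≉0 (suc k) = *-≉0 x≉0 (^-≉0 x≉0 k)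

  product-≉0 : ∀ {m} (u : Fin m → Carrier) → (∀ i → u i ≉ 0#) → product u ≉ 0#
  product-≉0 {zero}  u u≉0 = 1≉0
  product-≉0 {suc m} u u≉0 = *-≉0 (u≉0 Fin.zero) (product-≉0 (u ∘ Fin.suc) (u≉0 ∘ Fin.suc))

  *-cancelˡ : ∀ {x y z} → x ≉ 0# → x * y ≈ x * z → y ≈ z
  *-cancelˡ {x} {y} {z} x≉0 x*y≈x*z =
    x∙y⁻¹≈ε⇒x≈y y z (x≉0∧x*y≈0⇒y≈0 x≉0 (trans (x[y-z]≈xy-xz x y z) (x≈y⇒x∙y⁻¹≈ε x*y≈x*z)))

module FiniteField {c ℓ : Level} (K : CommutativeRing c ℓ)
  (isField : FieldNotions.IsField K) {n : ℕ} (card : FieldNotions.HasCard K n) where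
  open CommutativeRing K
  open FieldNotions K using (_^ᴷ_)
  open Field K isField
  open import Algebra.Properties.Ring ring using (+-cancelˡ)
  open import Algebra.Properties.Semiring.Mult semiring using () renaming (_×_ to _×ᴷ_)
  import Algebra.Properties.CommutativeMonoid.Sum as Sum
  private
    module Σ = Sum +-commutativeMonoid
    module Π = Sum *-commutativeMonoid
  open import Relation.Binary.Reasoning.Setoid setoid
  open import Data.Empty using (⊥-elim)

  private
    enum = proj₁ card
    enum-injective = proj₁ (proj₂ card)
    enum-surjective = proj₂ (proj₂ card)
    module Additive = SumProperties.Enumeration +-commutativeMonoid enum enum-injective enum-surjective
    module Multiplicative = SumProperties.Enumeration *-commutativeMonoid enum enum-injective enum-surjective

  open Additive using (≈-dec)

  -- Translation by 1 permutes K, so Σ y = Σ (1 + y) = n · 1 + Σ y.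
  n×1≈0 : n ×ᴷ 1# ≈ 0#
  n×1≈0 = +-cancelˡ S _ _ (begin
    S + n ×ᴷ 1#                    ≈⟨ +-comm S _ ⟩
    n ×ᴷ 1# + S                    ≈⟨ +-congʳ (Σ.sum-replicate n) ⟨
    Σ.sum {n} (λ _ → 1#) + S       ≈⟨ Σ.∑-distrib-+ (λ _ → 1#) enum ⟨
    Σ.sum (λ i → 1# + enum i)      ≈⟨ Additive.sum-translate (-‿inverseʳ 1#) (λ y → y) (λ y≈z → y≈z) ⟨
    S                              ≈⟨ +-identityʳ S ⟨
    S + 0#                         ∎)
    where S = Σ.sum enum

  ^≈0⇒≈0 : ∀ {x} k → x ^ᴷ k ≈ 0# → x ≈ 0#
  ^≈0⇒≈0 {x} k x^k≈0 with ≈-dec x 0#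
  ... | yes x≈0 = x≈0
  ... | no x≉0  = ⊥-elim (^-≉0 x≉0 k x^k≈0)

  unzero : Carrier → Carrier
  unzero y with ≈-dec y 0#
  ... | yes _ = 1#
  ... | no _  = y

  ifZero : Carrier → Carrier → Carrier
  ifZero x y with ≈-dec y 0#
  ... | yes _ = x
  ... | no _  = 1#

  unzero-cong : ∀ {y z} → y ≈ z → unzero y ≈ unzero z
  unzero-cong {y} {z} y≈z with ≈-dec y 0# | ≈-dec z 0#
  ... | yes _   | yes _   = refl
  ... | yes y≈0 | no z≉0  = ⊥-elim (z≉0 (trans (sym y≈z) y≈0))
  ... | no y≉0  | yes z≈0 = ⊥-elim (y≉0 (trans y≈z z≈0))
  ... | no _    | no _    = y≈z

  unzero-≉0 : ∀ y → unzero y ≉ 0#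
  unzero-≉0 y with ≈-dec y 0#
  ... | yes _   = 1≉0
  ... | no y≉0  = y≉0

  x*unzero[y]≈unzero[x*y]*ifZero : ∀ {x} → x ≉ 0# → ∀ y → x * unzero y ≈ unzero (x * y) * ifZero x y
  x*unzero[y]≈unzero[x*y]*ifZero {x} x≉0 y with ≈-dec y 0# | ≈-dec (x * y) 0#
  ... | yes _   | yes _     = *-comm x 1#
  ... | yes y≈0 | no xy≉0   = ⊥-elim (xy≉0 (trans (*-congˡ y≈0) (zeroʳ x)))
  ... | no y≉0  | yes xy≈0  = ⊥-elim (*-≉0 x≉0 y≉0 xy≈0)
  ... | no _    | no _      = sym (*-identityʳ _)

  ∏ifZero≈ : ∀ x → Π.sum (ifZero x ∘ enum) ≈ x
  ∏ifZero≈ x = trans (SumProperties.sum-≈-at *-commutativeMonoid (ifZero x ∘ enum) i₀ ifZero≈1) ifZero≈x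
    where
    i₀ = proj₁ (enum-surjective 0#)
    eᵢ₀≈0 = proj₂ (enum-surjective 0#)

    ifZero≈x : ifZero x (enum i₀) ≈ x
    ifZero≈x with ≈-dec (enum i₀) 0#
    ... | yes _   = refl
    ... | no e≉0  = ⊥-elim (e≉0 eᵢ₀≈0)

    ifZero≈1 : ∀ i → i ≢ i₀ → ifZero x (enum i) ≈ 1#
    ifZero≈1 i i≢i₀ with ≈-dec (enum i) 0#
    ... | yes eᵢ≈0 = ⊥-elim (i≢i₀ (enum-injective i i₀ (trans eᵢ≈0 (sym eᵢ₀≈0))))
    ... | no _     = refl

  -- P = ∏ unzero(y) is invariant under y ↦ x y, while x · unzero(y) = unzero(x y) except
  -- at y = 0; comparing the two products gives x^n P = P x.
  fermat : ∀ {x} → x ≉ 0# → x ^ᴷ n ≈ x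
  fermat {x} x≉0 with x⁻¹ , x*x⁻¹≈1 ← proj₂ isField x x≉0 =
    *-cancelˡ (product-≉0 (unzero ∘ enum) (unzero-≉0 ∘ enum)) (begin
      P * x ^ᴷ n
        ≈⟨ *-comm P _ ⟩
      x ^ᴷ n * P
        ≈⟨ *-congʳ (Π.sum-replicate n) ⟨
      Π.sum {n} (λ _ → x) * P
        ≈⟨ Π.∑-distrib-+ (λ _ → x) (unzero ∘ enum) ⟨
      Π.sum (λ i → x * unzero (enum i))
        ≈⟨ Π.sum-cong-≋ (x*unzero[y]≈unzero[x*y]*ifZero x≉0 ∘ enum) ⟩
      Π.sum (λ i → unzero (x * enum i) * ifZero x (enum i))
        ≈⟨ Π.∑-distrib-+ (λ i → unzero (x * enum i)) (ifZero x ∘ enum) ⟩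
      Π.sum (λ i → unzero (x * enum i)) * Π.sum (ifZero x ∘ enum)
        ≈⟨ *-cong (sym (Multiplicative.sum-translate x*x⁻¹≈1 unzero unzero-cong)) (∏ifZero≈ x) ⟩
      P * x
        ∎)
    where P = Π.sum (unzero ∘ enum)

module SetS {c ℓ : Level} (Q : ℕ) (Q-primePower : IsPrimePower Q) (Q-odd : Odd Q)
  (K : CommutativeRing c ℓ) (isField : FieldNotions.IsField K) (card : FieldNotions.HasCard K (Q ^ 4)) where
  open CommutativeRing K
  open FieldNotions K using (_^ᴷ_; InS; Tr; F5)
  open CommutativeRingProperties K
  open Field K isField
  open FiniteField K isField card
  open import Algebra.Properties.Ring ring using (+-inverseˡ-unique; -1*x≈-x)
  open import Algebra.Properties.Semiring.Exp semiring using (^-congˡ; ^-congʳ; ^-homo-*; ^-assocʳ)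
  open import Algebra.Properties.Semiring.Mult semiring using () renaming (_×_ to _×ᴷ_)
  open import Data.Nat.Divisibility using (_∣?_)
  open import Data.Nat.Primality using (prime?)
  open import Data.Integer using (+_)
  open import Relation.Nullary.Decidable using (decidable-stable; from-yes)
  open import Relation.Binary.Reasoning.Setoid setoid
  open IntegerCoefficientSolver K using (solve; _:=_; _:+_; _:*_; _:-_; :-_; _:^_; con)

  instance
    Q-nonZero : ℕ.NonZero Q
    Q-nonZero = ¬2∣⇒nonZero Q-odd

    N-nonZero : ℕ.NonZero (Q ^ 2)
    N-nonZero = ℕP.m^n≢0 Q 2

  N M : ℕ
  N = Q ^ 2
  M = N ∸ 1

  t : Carrier → Carrier
  t x = x ^ᴷ M

  x^N≈x*t : ∀ x → x ^ᴷ N ≈ x * t x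
  x^N≈x*t x = ^-congʳ x (m≡suc[m∸1] N)

  S-equation≈x²Φ₆[t] : ∀ x → x ^ᴷ (2 ℕ.* N) - x ^ᴷ (N ℕ.+ 1) + x ^ᴷ 2 ≈ (x * x) * Φ₆ (t x)
  S-equation≈x²Φ₆[t] x = begin
    x ^ᴷ (N ℕ.+ (N ℕ.+ 0)) - x ^ᴷ (N ℕ.+ 1) + x ^ᴷ 2
      ≈⟨ +-congʳ (+-cong (^-homo-* x N (N ℕ.+ 0)) (-‿cong (^-homo-* x N 1))) ⟩
    x ^ᴷ N * x ^ᴷ (N ℕ.+ 0) - x ^ᴷ N * x ^ᴷ 1 + x ^ᴷ 2
      ≈⟨ +-congʳ (+-cong (*-cong (x^N≈x*t x) (trans (^-congʳ x (ℕP.+-identityʳ N)) (x^N≈x*t x)))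
                          (-‿cong (*-congʳ (x^N≈x*t x)))) ⟩
    (x * t x) * (x * t x) - (x * t x) * x ^ᴷ 1 + x ^ᴷ 2
      ≈⟨ solve 2 (λ x t → (x :* t) :* (x :* t) :- (x :* t) :* x :^ 1 :+ x :^ 2
                       := (x :* x) :* (t :* t :- t :+ con (+ 1))) refl x (t x) ⟩
    (x * x) * Φ₆ (t x)
      ∎

  InS⇒Φ₆[t]≈0 : ∀ {x} → InS Q x → Φ₆ (t x) ≈ 0#
  InS⇒Φ₆[t]≈0 {x} (x≉0 , x∈S) = x≉0∧x*y≈0⇒y≈0 (*-≉0 x≉0 x≉0) (trans (sym (S-equation≈x²Φ₆[t] x)) x∈S)

  Φ₆[t]≈0⇒InS : ∀ {x} → x ≉ 0# → Φ₆ (t x) ≈ 0# → InS Q x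
  Φ₆[t]≈0⇒InS {x} x≉0 Φ₆[t]≈0 = x≉0 , trans (S-equation≈x²Φ₆[t] x) (trans (*-congˡ Φ₆[t]≈0) (zeroʳ _))

  t^[N+1]≈1 : ∀ {x} → x ≉ 0# → t x ^ᴷ (N ℕ.+ 1) ≈ 1#
  t^[N+1]≈1 {x} x≉0 = *-cancelˡ x≉0 (begin
    x * t x ^ᴷ (N ℕ.+ 1)         ≈⟨ *-congˡ (^-assocʳ x M (N ℕ.+ 1)) ⟩
    x ^ᴷ suc (M ℕ.* (N ℕ.+ 1))   ≈⟨ ^-congʳ x (≡.trans (suc[[m∸1]*[m+1]]≡m*m N) (≡.sym (ℕP.^-distribˡ-+-* Q 2 2))) ⟩
    x ^ᴷ (Q ^ 4)                 ≈⟨ fermat x≉0 ⟩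
    x                            ≈⟨ *-identityʳ x ⟨
    x * 1#                       ∎)

  ¬3∣Q⇒¬InS : ¬ 3 ∣ Q → ∀ {x} → ¬ InS Q x
  ¬3∣Q⇒¬InS ¬3∣Q {x} x∈S@(x≉0 , _) = 1≉0 (begin
    1#                   ≈⟨ [1+m*k]×1≈1 3 m (Φ₆≈0⇒^2≈1⇒3×1≈0 Φ₆[t]≈0 t²≈1) ⟨
    suc (3 ℕ.* m) ×ᴷ 1#  ≡⟨ ≡.cong (_×ᴷ 1#) Q⁴≡1+3m ⟨
    (Q ^ 4) ×ᴷ 1#        ≈⟨ n×1≈0 ⟩
    0#                   ∎)
    where
    k = proj₁ (n*n≡1+6*k Q Q-odd ¬3∣Q)
    m = 4 ℕ.* k ℕ.+ 12 ℕ.* k ℕ.* k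

    N≡1+6k : N ≡ 1 ℕ.+ 6 ℕ.* k
    N≡1+6k = ≡.trans (≡.cong (Q ℕ.*_) (ℕP.*-identityʳ Q)) (proj₂ (n*n≡1+6*k Q Q-odd ¬3∣Q))

    Q⁴≡1+3m : Q ^ 4 ≡ suc (3 ℕ.* m)
    Q⁴≡1+3m = ≡.trans (ℕP.^-distribˡ-+-* Q 2 2)
                (≡.trans (≡.cong₂ ℕ._*_ N≡1+6k N≡1+6k) ([1+6k]*[1+6k]≡1+3*[4k+12k*k] k))

    Φ₆[t]≈0 : Φ₆ (t x) ≈ 0#
    Φ₆[t]≈0 = InS⇒Φ₆[t]≈0 x∈S

    t²≈1 : t x ^ᴷ 2 ≈ 1#
    t²≈1 = begin
      t x ^ᴷ 2                    ≈⟨ ^-periodic {p = 6} (Φ₆≈0⇒^6≈1 Φ₆[t]≈0) 2 k ⟨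
      t x ^ᴷ (2 ℕ.+ 6 ℕ.* k)      ≈⟨ ^-congʳ (t x) (≡.trans (≡.cong (ℕ._+ 1) N≡1+6k) (ℕP.+-comm (1 ℕ.+ 6 ℕ.* k) 1)) ⟨
      t x ^ᴷ (N ℕ.+ 1)            ≈⟨ t^[N+1]≈1 x≉0 ⟩
      1#                          ∎

  InS⇒3∣Q : ∀ {x} → InS Q x → 3 ∣ Q
  InS⇒3∣Q x∈S = decidable-stable (3 ∣? Q) (λ ¬3∣Q → ¬3∣Q⇒¬InS ¬3∣Q x∈S)

  3∣Q⇒3×1≈0 : 3 ∣ Q → 3 ×ᴷ 1# ≈ 0#
  3∣Q⇒3×1≈0 3∣Q = ^≈0⇒≈0 (k ℕ.* 4) (begin
    (3 ×ᴷ 1#) ^ᴷ (k ℕ.* 4)   ≈⟨ ×1-homo-^ 3 (k ℕ.* 4) ⟨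
    (3 ^ (k ℕ.* 4)) ×ᴷ 1#    ≡⟨ ≡.cong (_×ᴷ 1#) (≡.trans (≡.cong (_^ 4) Q≡3^k) (ℕP.^-*-assoc 3 k 4)) ⟨
    (Q ^ 4) ×ᴷ 1#            ≈⟨ n×1≈0 ⟩
    0#                       ∎)
    where
    p = proj₁ Q-primePower
    k = proj₁ (proj₂ Q-primePower)
    Q≡p^k = proj₂ (proj₂ (proj₂ (proj₂ Q-primePower)))
    3≡p = prime∣prime^⇒≡ k (from-yes (prime? 3)) (proj₁ (proj₂ (proj₂ Q-primePower))) (≡.subst (3 ∣_) Q≡p^k 3∣Q)
    Q≡3^k = ≡.trans Q≡p^k (≡.cong (_^ k) (≡.sym 3≡p))

  module Characteristic3 (3×1≈0 : 3 ×ᴷ 1# ≈ 0#) where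

    InS⇒t≈-1 : ∀ {x} → InS Q x → t x ≈ - 1#
    InS⇒t≈-1 x∈S = +-inverseˡ-unique _ _
      (^≈0⇒≈0 2 (trans (3×1≈0⇒[t+1]^2≈Φ₆ 3×1≈0 _) (InS⇒Φ₆[t]≈0 x∈S)))

    t≈-1⇒InS : ∀ {x} → t x ≈ - 1# → InS Q x
    t≈-1⇒InS {x} t≈-1 = Φ₆[t]≈0⇒InS x≉0 (begin
      Φ₆ (t x)              ≈⟨ 3×1≈0⇒[t+1]^2≈Φ₆ 3×1≈0 (t x) ⟨
      (t x + 1#) ^ᴷ 2       ≈⟨ ^-congˡ 2 (trans (+-congʳ t≈-1) (-‿inverseˡ 1#)) ⟩
      0# ^ᴷ 2               ≈⟨ zeroˡ _ ⟩
      0#                    ∎)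
      where
      x≉0 : x ≉ 0#
      x≉0 x≈0 = 1≉0 (3×1≈0⇒0^k≈-1⇒1≈0 3×1≈0 M (trans (^-congˡ M (sym x≈0)) t≈-1))

  x^N≈-x⇒F5≈x : ∀ {x} → x ≉ 0# → x ^ᴷ N ≈ - x → F5 Q x ≈ x
  x^N≈-x⇒F5≈x {x} x≉0 x^N≈-x = begin
    x - Tr Q (x ^ᴷ e)          ≈⟨ +-congˡ (-‿cong (+-cong (^-congˡ N x^e≈-x) x^e≈-x)) ⟩
    x - ((- x) ^ᴷ N + - x)     ≈⟨ +-congˡ (-‿cong (+-congʳ (trans (-‿^-odd N (¬2∣⇒¬2∣^ 2 Q-odd) x) (-‿cong x^N≈-x)))) ⟩
    x - (- - x + - x)          ≈⟨ solve 1 (λ x → x :- (:- :- x :+ :- x) := x) refl x ⟩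
    x                          ∎
    where
    e = Q ^ 3 ∸ Q ℕ.+ 1

    x^Q³≈-x^Q : x ^ᴷ (Q ^ 3) ≈ - (x ^ᴷ Q)
    x^Q³≈-x^Q = begin
      x ^ᴷ (Q ℕ.* N)     ≡⟨ ≡.cong (x ^ᴷ_) (ℕP.*-comm Q N) ⟩
      x ^ᴷ (N ℕ.* Q)     ≈⟨ ^-assocʳ x N Q ⟨
      (x ^ᴷ N) ^ᴷ Q      ≈⟨ ^-congˡ Q x^N≈-x ⟩
      (- x) ^ᴷ Q         ≈⟨ -‿^-odd Q Q-odd x ⟩
      - (x ^ᴷ Q)         ∎

    x^e≈-x : x ^ᴷ e ≈ - x
    x^e≈-x = *-cancelˡ (^-≉0 x≉0 Q) (begin
      x ^ᴷ Q * x ^ᴷ e          ≈⟨ ^-homo-* x Q e ⟨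
      x ^ᴷ (Q ℕ.+ e)           ≡⟨ ≡.cong (x ^ᴷ_) (m+[n∸m+1]≡n+1 (ℕP.m≤m*n Q N)) ⟩
      x ^ᴷ (Q ^ 3 ℕ.+ 1)       ≈⟨ ^-homo-* x (Q ^ 3) 1 ⟩
      x ^ᴷ (Q ^ 3) * x ^ᴷ 1    ≈⟨ *-congʳ x^Q³≈-x^Q ⟩
      - (x ^ᴷ Q) * x ^ᴷ 1      ≈⟨ solve 2 (λ y x → :- y :* x :^ 1 := y :* :- x) refl (x ^ᴷ Q) x ⟩
      x ^ᴷ Q * - x             ∎)

  InS⇒F5≈x : ∀ {x} → InS Q x → F5 Q x ≈ x
  InS⇒F5≈x {x} x∈S@(x≉0 , _) = x^N≈-x⇒F5≈x x≉0 (begin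
    x ^ᴷ N         ≈⟨ x^N≈x*t x ⟩
    x * t x        ≈⟨ *-congˡ (Characteristic3.InS⇒t≈-1 (3∣Q⇒3×1≈0 (InS⇒3∣Q x∈S)) x∈S) ⟩
    x * - 1#       ≈⟨ *-comm x _ ⟩
    - 1# * x       ≈⟨ -1*x≈-x x ⟩
    - x            ∎)

lemma6p3 : {c ℓ : Level} (Q : ℕ) → IsPrimePower Q → Odd Q →
           (K : CommutativeRing c ℓ) →
           let open CommutativeRing K
               open FieldNotions K
           in IsField → HasCard (Q ^ 4) →
              ((∃ λ x → InS Q x) → 3 ∣ Q)
              × (3 ∣ Q → ∀ x → (InS Q x → x ^ᴷ (Q ^ 2 ∸ 1) ≈ - 1#)
                              × (x ^ᴷ (Q ^ 2 ∸ 1) ≈ - 1# → InS Q x))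
              × (∀ x → InS Q x → F5 Q x ≈ x)
lemma6p3 Q Q-primePower Q-odd K isField card =
  (λ (_ , x∈S) → InS⇒3∣Q x∈S) ,
  (λ 3∣Q _ → Characteristic3.InS⇒t≈-1 (3∣Q⇒3×1≈0 3∣Q) , Characteristic3.t≈-1⇒InS (3∣Q⇒3×1≈0 3∣Q)) ,
  (λ _ → InS⇒F5≈x)
  where open SetS Q Q-primePower Q-odd K isField card
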